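{- Let $\mathcal G$ be an MCS and $f=f_{\mu_L,\mu_H}$ a (possibly tagged) bi-multiset level mapping. Let $g=p(\bar x)\,:\!-\,\pi;\,q(\bar y)\in\mathcal G$ be such that every cycle $\mathcal C$ of the control-flow graph of $\mathcal G$ that includes $g$ satisfies: (1) all transition rules in $\mathcal C$ are oriented by $f$, and at least one of them strictly; (2) at least one transition rule in $\mathcal C$ is bounded w.r.t. $f$. Then $g$ is a $\Phi_f$-anchor for $\mathcal G$, where $\Phi_f(p(\bar x))=p_f^{high}(\bar x)-p_f^{low}(\bar x)$, taking values in multisets of integers quasi-ordered by $\succsim^{\mu_D}$ ($\mu_D$ the type of the difference) with well-founded subset $\mathcal D_+$ the well-founded subset of that type.
   Context: MCS: a finite set of transition rules over program points with fixed arities; a rule is $p(\bar x)\,:\!-\,\pi;\,q(\bar y)$ with $\bar x,\bar y$ tuples of distinct variables of the arities of $p,q$ and $\pi$ a conjunction of constraints $a>b$, $a\ge b$, $a,b\in\bar x\cup\bar y$, over $\mathbb Z$; $\pi\models R$ means $R$ holds under every integer assignment satisfying $\pi$. A state is $p(\bar x)$ with $\bar x$ integers. The control-flow graph has the program points as vertices and an arc $p\to q$ for each rule; a cycle of $\mathcal G$ is a cycle of this multigraph (a sequence of rules). A run is a sequence of states where each consecutive pair corresponds to a rule of $\mathcal G$ whose constraint is satisfied by the values. Orders on finite integer multisets: (max) $S\succsim^{max}T$ iff $\max S\ge\max T$ or $T=\emptyset$; $S\succ^{max}T$ iff $\max S>\max T$ or ($T=\emptyset\ne S$). (min) $S\succsim^{min}T$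 iff $\min S\ge\min T$ or $S=\emptyset$; $S\succ^{min}T$ iff $\min S>\min T$ or ($S=\emptyset\ne T$). (ms) $S\succ^{ms}T$ iff $T$ arises from $S$ by replacing a non-empty sub-multiset $U$ by some $V$ with $U\succ^{max}V$; $\succsim^{ms}$ is $\succ^{ms}$ or equality. (dms) $S\succ^{dms}T$ iff $T$ arises from $S$ by replacing a sub-multiset $U$ by a non-empty $V$ with $U\succ^{min}V$; $\succsim^{dms}$ is $\succ^{dms}$ or equality. Well-founded subsets: for $min$/$max$, multisets with non-negative minimum/maximum; for $ms$/$dms$, multisets with all elements non-negative. Multiset difference of non-empty $L,H$ of types $\mu_L,\mu_H$: if $\mu_L\in\{max,min\}$, $H-L=\{h-\mu_L(L):h\in H\}$ of type $\mu_H$; if $\mu_L\in\{ms,dms\}$, $\mu_H\in\{min,max\}$, $H-L=\{\mu_H(H)-\ell:\ell\in L\}$ of type $dms$ (if $\mu_L=ms$) or $ms$ (if $\mu_L=dms$); otherwise undefined ($\mu_L,\mu_H$ compatible iff defined). $H\sqsupseteq_+ L$ means $H-L$ lies in the well-founded subset of its type. Level mapping $f_{\mu_L,\mu_H}$ ($\mu_L,\mu_H$ compatible): assigns to each program point $p$ a low and a high selection of its argument positions (depending only on $p$), giving multisets $p_f^{low}(\bar x)$ (type $\mu_L$) and $p_f^{high}(\bar x)$ (type $\mu_H$) of the selected values; in a tagged level mapping each selected position $i$ has a tag $t\in\{0,\dots,M-1\}$, $M$ the sum of all arities, and contributes $Mx_i+t$. $f$ orients $g=p(\bar x)\,:\!-\,\pi;\,q(\bar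 y)$ if $\pi\models p_f^{high}(\bar x)\succsim^{\mu_H}q_f^{high}(\bar y)$ and $\pi\models q_f^{low}(\bar y)\succsim^{\mu_L}p_f^{low}(\bar x)$; strictly if moreover $\pi\models p_f^{high}(\bar x)\succ^{\mu_H}q_f^{high}(\bar y)$ or $\pi\models q_f^{low}(\bar y)\succ^{\mu_L}p_f^{low}(\bar x)$. $g$ is bounded w.r.t. $f$ if $\pi\models p_f^{high}(\bar x)\sqsupseteq_+ p_f^{low}(\bar x)$. Anchor: for $\Phi$ from states to a quasi-order $(\mathcal D,\succsim)$ with well-founded subset $\mathcal D_+$, $g$ is a $\Phi$-anchor for $\mathcal G$ if for every run $p_0(\bar x_0)\to\cdots\to p_k(\bar x_k)\to p_{k+1}(\bar x_{k+1})$ of $\mathcal G$ whose first and last steps both correspond to $g$, $\Phi(p_i(\bar x_i))\succsim\Phi(p_{i+1}(\bar x_{i+1}))$ for all $0\le i\le k$, at least one strictly, and $\Phi(p_i(\bar x_i))\in\mathcal D_+$ for some $0\le i\le k$. -}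

module Defs where

open import Data.Nat as ℕ using (ℕ; zero; suc)
open import Data.Integer as ℤ using (ℤ; +_; _-_; _⊔_; _⊓_)
open import Data.Fin using (Fin; zero; suc; inject₁; fromℕ; toℕ)
open import Data.List using (List; []; _∷_; _++_; map; mapMaybe; allFin; foldr)
open import Data.Nat.ListAction using (sum)
open import Data.List.Relation.Unary.All using (All)
open import Data.List.Relation.Binary.Permutation.Propositional using (_↭_)
open import Data.List.Membership.Propositional using (_∈_)
open import Data.Maybe using (Maybe; just; nothing)
open import Data.Bool using (Bool; true; false)
open import Data.Sum using (_⊎_; [_,_])
open import Data.Product using (_×_; ∃; Σ)
open import Data.Unit using (⊤)
open import Data.Empty using (⊥)
open import Relation.Binary.PropositionalEquality using (_≡_; _≢_)

data Rel : Set where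
  gt ge : Rel

module _ {n : ℕ} (ar : Fin n → ℕ) where

  -- a variable of a rule p(x̄) :- π; q(ȳ): a position of x̄ or of ȳ
  Var : Fin n → Fin n → Set
  Var p q = Fin (ar p) ⊎ Fin (ar q)

  record Constraint (p q : Fin n) : Set where
    constructor con
    field
      lhs : Var p q
      rel : Rel
      rhs : Var p q

  record Rule : Set where
    constructor rule
    field
      src : Fin n
      tgt : Fin n
      cons : List (Constraint src tgt)

  record State : Set where
    constructor ⟨_,_⟩
    field
      pt  : Fin n
      val : Fin (ar pt) → ℤ

open Rule public
open State public

module _ {n : ℕ} {ar : Fin n → ℕ} where

  holdsRel : Rel → ℤ → ℤ → Set
  holdsRel gt a b = b ℤ.< a
  holdsRel ge a b = b ℤ.≤ a

  SatC : {p q : Fin n} → Constraint ar p q →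
         (Fin (ar p) → ℤ) → (Fin (ar q) → ℤ) → Set
  SatC (con a r b) xs ys = holdsRel r ([ xs , ys ] a) ([ xs , ys ] b)

  Sat : (r : Rule ar) → (Fin (ar (src r)) → ℤ) → (Fin (ar (tgt r)) → ℤ) → Set
  Sat r xs ys = All (λ c → SatC c xs ys) (cons r)

  _⊨_ : (r : Rule ar) →
        ((Fin (ar (src r)) → ℤ) → (Fin (ar (tgt r)) → ℤ) → Set) → Set
  r ⊨ R = ∀ xs ys → Sat r xs ys → R xs ys

  data Step (r : Rule ar) : State ar → State ar → Set where
    step : ∀ xs ys → Sat r xs ys → Step r ⟨ src r , xs ⟩ ⟨ tgt r , ys ⟩

  -- a cycle of the control-flow graph of G (closed walk, given as a
  -- non-empty cyclic sequence of rules of G) that includes g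
  CycleThrough : List (Rule ar) → Rule ar → (m : ℕ) → (Fin (suc m) → Rule ar) → Set
  CycleThrough G g m c =
    (∀ i → c i ∈ G) ×
    (∀ (i : Fin m) → tgt (c (inject₁ i)) ≡ src (c (suc i))) ×
    (tgt (c (fromℕ m)) ≡ src (c zero)) ×
    (∃ λ i → c i ≡ g)

  -- Φ-anchor (Φ into multisets with quasi-order ≿, strict part ≻,
  -- well-founded subset D₊).  A run with first and last step via g has
  -- k+2 ≥ 2 steps (first and last steps are distinct steps).
  Anchor : List (Rule ar) → Rule ar → (State ar → List ℤ) →
           (List ℤ → List ℤ → Set) → (List ℤ → List ℤ → Set) →
           (List ℤ → Set) → Set
  Anchor G g Φ _≿_ _≻_ D₊ =
    ∀ (k : ℕ) (st : Fin (suc (suc (suc k))) → State ar)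
      (rs : Fin (suc (suc k)) → Rule ar) →
    (∀ i → rs i ∈ G) →
    (∀ i → Step (rs i) (st (inject₁ i)) (st (suc i))) →
    rs zero ≡ g → rs (fromℕ (suc k)) ≡ g →
    (∀ i → Φ (st (inject₁ i)) ≿ Φ (st (suc i))) ×
    (∃ λ i → Φ (st (inject₁ i)) ≻ Φ (st (suc i))) ×
    (∃ λ i → D₊ (Φ (st (inject₁ i))))

-- Multiset orders (multisets of integers represented as lists,
-- multiset equality = permutation _↭_)

data MType : Set where
  max min ms dms : MType

maxNE : ℤ → List ℤ → ℤ
maxNE s ss = foldr _⊔_ s ss

minNE : ℤ → List ℤ → ℤ
minNE s ss = foldr _⊓_ s ss

_≿max_ : List ℤ → List ℤ → Set
_ ≿max [] = ⊤
[] ≿max (_ ∷ _) = ⊥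
(s ∷ ss) ≿max (t ∷ ts) = maxNE t ts ℤ.≤ maxNE s ss

_≻max_ : List ℤ → List ℤ → Set
[] ≻max _ = ⊥
(_ ∷ _) ≻max [] = ⊤
(s ∷ ss) ≻max (t ∷ ts) = maxNE t ts ℤ.< maxNE s ss

_≿min_ : List ℤ → List ℤ → Set
[] ≿min _ = ⊤
(_ ∷ _) ≿min [] = ⊥
(s ∷ ss) ≿min (t ∷ ts) = minNE t ts ℤ.≤ minNE s ss

_≻min_ : List ℤ → List ℤ → Set
[] ≻min [] = ⊥
[] ≻min (_ ∷ _) = ⊤
(_ ∷ _) ≻min [] = ⊥
(s ∷ ss) ≻min (t ∷ ts) = minNE t ts ℤ.< minNE s ss

_≻ms_ : List ℤ → List ℤ → Set
S ≻ms T = ∃ λ U → ∃ λ V → ∃ λ R →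
  (S ↭ U ++ R) × (T ↭ V ++ R) × (U ≢ []) × (U ≻max V)

_≿ms_ : List ℤ → List ℤ → Set
S ≿ms T = (S ≻ms T) ⊎ (S ↭ T)

_≻dms_ : List ℤ → List ℤ → Set
S ≻dms T = ∃ λ U → ∃ λ V → ∃ λ R →
  (S ↭ U ++ R) × (T ↭ V ++ R) × (V ≢ []) × (U ≻min V)

_≿dms_ : List ℤ → List ℤ → Set
S ≿dms T = (S ≻dms T) ⊎ (S ↭ T)

≿[_] : MType → List ℤ → List ℤ → Set
≿[ max ] = _≿max_
≿[ min ] = _≿min_
≿[ ms ]  = _≿ms_
≿[ dms ] = _≿dms_

≻[_] : MType → List ℤ → List ℤ → Set
≻[ max ] = _≻max_
≻[ min ] = _≻min_
≻[ ms ]  = _≻ms_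
≻[ dms ] = _≻dms_

WF[_] : MType → List ℤ → Set
WF[ max ] [] = ⊥
WF[ max ] (s ∷ ss) = + 0 ℤ.≤ maxNE s ss
WF[ min ] [] = ⊥
WF[ min ] (s ∷ ss) = + 0 ℤ.≤ minNE s ss
WF[ ms ] S = All (λ x → + 0 ℤ.≤ x) S
WF[ dms ] S = All (λ x → + 0 ℤ.≤ x) S

-- Multiset difference H - L (only defined for compatible types)

data Compat : MType → MType → Set where
  maxL   : ∀ μH → Compat max μH
  minL   : ∀ μH → Compat min μH
  ms-max  : Compat ms max
  ms-min  : Compat ms min
  dms-max : Compat dms max
  dms-min : Compat dms min

dtype : ∀ {μL μH} → Compat μL μH → MType
dtype (maxL μH) = μH
dtype (minL μH) = μH
dtype ms-max = dms
dtype ms-min = dms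
dtype dms-max = ms
dtype dms-min = ms

-- μ(S) for μ ∈ {max, min}, S non-empty (the value on ∅ is never used:
-- the difference is only taken of non-empty multisets)
μval : MType → List ℤ → ℤ
μval max [] = + 0
μval max (s ∷ ss) = maxNE s ss
μval min [] = + 0
μval min (s ∷ ss) = minNE s ss
μval ms _ = + 0
μval dms _ = + 0

-- difference H - L  (arguments: L then H)
diff : ∀ {μL μH} → Compat μL μH → List ℤ → List ℤ → List ℤ
diff (maxL _) L H = map (λ h → h - μval max L) H
diff (minL _) L H = map (λ h → h - μval min L) H
diff {μH = μH} ms-max  L H = map (λ l → μval μH H - l) L
diff {μH = μH} ms-min  L H = map (λ l → μval μH H - l) L
diff {μH = μH} dms-max L H = map (λ l → μval μH H - l) L
diff {μH = μH} dms-min L H = map (λ l → μval μH H - l) L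

totalArity : {n : ℕ} → (Fin n → ℕ) → ℕ
totalArity {n} ar = sum (map ar (allFin n))

module _ {n : ℕ} (ar : Fin n → ℕ) where

  -- a selection of the argument positions of each program point; a
  -- selected position carries a tag in {0,…,M-1} (ignored if untagged)
  record LevelMapping : Set where
    field
      tagged : Bool
      low    : (p : Fin n) → Fin (ar p) → Maybe (Fin (totalArity ar))
      high   : (p : Fin n) → Fin (ar p) → Maybe (Fin (totalArity ar))

open LevelMapping public

module _ {n : ℕ} {ar : Fin n → ℕ} where

  contrib : Bool → Fin (totalArity ar) → ℤ → ℤ
  contrib false t x = x
  contrib true  t x = + totalArity ar ℤ.* x ℤ.+ + toℕ t

  selMS : Bool → {p : Fin n} → (Fin (ar p) → Maybe (Fin (totalArity ar))) →
          (Fin (ar p) → ℤ) → List ℤ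
  selMS b {p} sel xs = mapMaybe pick (allFin (ar p))
    where
    pick : Fin (ar p) → Maybe ℤ
    pick i with sel i
    ... | nothing = nothing
    ... | just t  = just (contrib b t (xs i))

  lowMS : LevelMapping ar → (p : Fin n) → (Fin (ar p) → ℤ) → List ℤ
  lowMS f p = selMS (tagged f) (low f p)

  highMS : LevelMapping ar → (p : Fin n) → (Fin (ar p) → ℤ) → List ℤ
  highMS f p = selMS (tagged f) (high f p)

  -- both selections of every program point are non-empty
  -- (needed for the multiset difference, hence Φ_f, to be defined)
  NonEmptySelections : LevelMapping ar → Set
  NonEmptySelections f =
    ∀ p → (∃ λ i → ∃ λ t → low f p i ≡ just t) ×
          (∃ λ i → ∃ λ t → high f p i ≡ just t)

  module _ {μL μH : MType} where

    Orients : LevelMapping ar → Rule ar → Set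
    Orients f r =
      (r ⊨ λ xs ys → ≿[ μH ] (highMS f (src r) xs) (highMS f (tgt r) ys)) ×
      (r ⊨ λ xs ys → ≿[ μL ] (lowMS f (tgt r) ys) (lowMS f (src r) xs))

    OrientsStrictly : LevelMapping ar → Rule ar → Set
    OrientsStrictly f r = Orients f r ×
      ((r ⊨ λ xs ys → ≻[ μH ] (highMS f (src r) xs) (highMS f (tgt r) ys)) ⊎
       (r ⊨ λ xs ys → ≻[ μL ] (lowMS f (tgt r) ys) (lowMS f (src r) xs)))

  _⊒₊_ : ∀ {μL μH} → (c : Compat μL μH) → List ℤ → List ℤ → Set
  (c ⊒₊ H) L = WF[ dtype c ] (diff c L H)

  Bounded : ∀ {μL μH} → Compat μL μH → LevelMapping ar → Rule ar → Set
  Bounded c f r = r ⊨ λ xs ys → (c ⊒₊ highMS f (src r) xs) (lowMS f (src r) xs)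

  Φ : ∀ {μL μH} → Compat μL μH → LevelMapping ar → State ar → List ℤ
  Φ c f ⟨ p , xs ⟩ = diff c (lowMS f p xs) (highMS f p xs)

-- Write H and L for the high and low multisets of a state, so that Φ_f = H - L.
-- An oriented step weakly decreases H and weakly increases L.  If μ_L is max or
-- min, H - L is H shifted down by μ_L(L); otherwise it is μ_H(H) - L, which is
-- -L (negation exchanges max with min and ms with dms) shifted down by -μ_H(H).
-- For each of the four orders, H ≿ H' and a ≤ b give H - a ≿ H' - b, strictly
-- if H ≻ H' or a < b, so a (strictly) oriented step (strictly) decreases Φ_f.
-- Finally, the first k+1 steps of a run whose first and last steps use g form a
-- cycle through g, and the last step uses g, the first rule of that cycle.
module Submission where

open import Defs
open import Data.Nat using (ℕ; suc)
open import Data.Fin using (Fin; zero; suc; inject₁; fromℕ)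
open import Data.Fin.Relation.Unary.Top using (view; ‵fromℕ; ‵inject₁)
open import Data.Integer using (ℤ; _≤_; _<_; _+_; _-_; -_; _⊔_; _⊓_; _≟_)
open import Data.Integer.Properties
open import Data.List using (List; []; _∷_; _++_; map; mapMaybe; allFin)
open import Data.List.Properties
  using (map-++; ++-identityʳ; map-∘; map-cong; foldr-preservesᵒ)
open import Data.List.Membership.Propositional using (_∈_)
open import Data.List.Membership.Propositional.Properties
  using (∈-map⁺; ∈-map⁻; ∈-++⁺ˡ; ∈-++⁺ʳ; ∈-++⁻; ∈-allFin; foldr-selective)
open import Data.List.Relation.Unary.Any using (Any; here; there)
import Data.List.Relation.Unary.Any as Any
import Data.List.Relation.Unary.Any.Properties as Any
open import Data.List.Relation.Binary.Permutation.Propositional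
  using (_↭_; ↭-sym; ↭-reflexive)
import Data.List.Relation.Binary.Permutation.Propositional.Properties as ↭
open import Data.Maybe using (Maybe; just; nothing)
open import Data.Product using (_×_; ∃; ∃-syntax; _,_)
open import Data.Sum using (_⊎_; inj₁; inj₂; [_,_]; [_,_]′; map₁; map₂)
import Data.Sum as Sum
open import Data.Unit using (tt)
open import Data.Empty using (⊥-elim)
open import Function using (_∘_)
open import Relation.Nullary using (yes; no)
open import Relation.Binary.PropositionalEquality
  using (_≡_; _≢_; refl; sym; trans; cong; subst; module ≡-Reasoning)

private
  variable
    a b α β x : ℤ
    S T H H' L L' : List ℤ

map≢[] : ∀ {A B : Set} {f : A → B} {xs : List A} → xs ≢ [] → map f xs ≢ []
map≢[] {xs = []} xs≢[] = ⊥-elim (xs≢[] refl)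
map≢[] {xs = _ ∷ _} _ = λ ()

mapMaybe≡[]⇒nothing : ∀ {A B : Set} (f : A → Maybe B) {y : A} xs →
                      mapMaybe f xs ≡ [] → y ∈ xs → f y ≡ nothing
mapMaybe≡[]⇒nothing f (x ∷ xs) e y∈ with f x in fx
mapMaybe≡[]⇒nothing f (x ∷ xs) () y∈ | just _
mapMaybe≡[]⇒nothing f (x ∷ xs) e (here refl) | nothing = fx
mapMaybe≡[]⇒nothing f (x ∷ xs) e (there y∈) | nothing = mapMaybe≡[]⇒nothing f xs e y∈

map-↭++ : ∀ (f : ℤ → ℤ) {S} U R → S ↭ U ++ R → map f S ↭ map f U ++ map f R
map-↭++ f {S} U R p = subst (map f S ↭_) (map-++ f U R) (↭.map⁺ f p)

↭++[] : ∀ (S : List ℤ) → S ↭ S ++ []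
↭++[] S = ↭-reflexive (sym (++-identityʳ S))

≤-max : x ∈ S → x ≤ μval max S
≤-max {x = x} {S = s ∷ ss} x∈S = foldr-preservesᵒ upper s ss (split x∈S)
  where
  upper : ∀ a b → x ≤ a ⊎ x ≤ b → x ≤ a ⊔ b
  upper a b = [ (λ x≤a → ≤-trans x≤a (i≤i⊔j a b)) , i≤j⇒i≤k⊔j a ]
  split : x ∈ s ∷ ss → x ≤ s ⊎ Any (x ≤_) ss
  split (here refl) = inj₁ ≤-refl
  split (there x∈ss) = inj₂ (Any.map ≤-reflexive x∈ss)

min-≤ : x ∈ S → μval min S ≤ x
min-≤ {x = x} {S = s ∷ ss} x∈S = foldr-preservesᵒ lower s ss (split x∈S)
  where
  lower : ∀ a b → a ≤ x ⊎ b ≤ x → a ⊓ b ≤ x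
  lower a b = [ (λ a≤x → ≤-trans (i⊓j≤i a b) a≤x) , i≤j⇒k⊓i≤j a ]
  split : x ∈ s ∷ ss → s ≤ x ⊎ Any (_≤ x) ss
  split (here refl) = inj₁ ≤-refl
  split (there x∈ss) = inj₂ (Any.map (≤-reflexive ∘ sym) x∈ss)

max-∈ : S ≢ [] → μval max S ∈ S
max-∈ {S = []} S≢[] = ⊥-elim (S≢[] refl)
max-∈ {S = s ∷ ss} _ = [ here , there ]′ (foldr-selective ⊔-sel s ss)

min-∈ : S ≢ [] → μval min S ∈ S
min-∈ {S = []} S≢[] = ⊥-elim (S≢[] refl)
min-∈ {S = s ∷ ss} _ = [ here , there ]′ (foldr-selective ⊓-sel s ss)

-- The max and min orders in terms of domination

Majorises : List ℤ → List ℤ → Set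
Majorises S T = ∀ {y} → y ∈ T → ∃[ x ] x ∈ S × y ≤ x

StrictlyMajorises : List ℤ → List ℤ → Set
StrictlyMajorises S T = ∃[ x ] x ∈ S × (∀ {y} → y ∈ T → y < x)

Minorises : List ℤ → List ℤ → Set
Minorises T S = ∀ {x} → x ∈ S → ∃[ y ] y ∈ T × y ≤ x

StrictlyMinorises : List ℤ → List ℤ → Set
StrictlyMinorises T S = ∃[ y ] y ∈ T × (∀ {x} → x ∈ S → y < x)

majorises⇒≿max : Majorises S T → S ≿max T
majorises⇒≿max {T = []} _ = tt
majorises⇒≿max {[]} {t ∷ ts} S≥T with S≥T (here refl)
... | _ , () , _
majorises⇒≿max {s ∷ ss} {t ∷ ts} S≥T with S≥T (max-∈ {S = t ∷ ts} λ ())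
... | x , x∈S , maxT≤x = ≤-trans maxT≤x (≤-max x∈S)

≿max⇒majorises : S ≿max T → Majorises S T
≿max⇒majorises {[]} {t ∷ ts} ()
≿max⇒majorises {s ∷ ss} {t ∷ ts} maxT≤maxS y∈T =
  μval max (s ∷ ss) , max-∈ (λ ()) , ≤-trans (≤-max y∈T) maxT≤maxS

strictlyMajorises⇒≻max : StrictlyMajorises S T → S ≻max T
strictlyMajorises⇒≻max {s ∷ ss} {[]} _ = tt
strictlyMajorises⇒≻max {s ∷ ss} {t ∷ ts} (x , x∈S , T<x) =
  <-≤-trans (T<x (max-∈ {S = t ∷ ts} λ ())) (≤-max x∈S)

≻max⇒strictlyMajorises : S ≻max T → StrictlyMajorises S T
≻max⇒strictlyMajorises {s ∷ ss} {[]} _ = s , here refl , λ ()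
≻max⇒strictlyMajorises {s ∷ ss} {t ∷ ts} maxT<maxS =
  μval max (s ∷ ss) , max-∈ (λ ()) , λ y∈T → ≤-<-trans (≤-max y∈T) maxT<maxS

minorises⇒≿min : Minorises T S → S ≿min T
minorises⇒≿min {S = []} _ = tt
minorises⇒≿min {T = t ∷ ts} {S = s ∷ ss} T≤S with T≤S (min-∈ {S = s ∷ ss} λ ())
... | y , y∈T , y≤minS = ≤-trans (min-≤ y∈T) y≤minS
minorises⇒≿min {T = []} {S = s ∷ ss} T≤S with T≤S (here refl)
... | _ , () , _

≿min⇒minorises : S ≿min T → Minorises T S
≿min⇒minorises {s ∷ ss} {[]} ()
≿min⇒minorises {s ∷ ss} {t ∷ ts} minT≤minS x∈S =
  μval min (t ∷ ts) , min-∈ (λ ()) , ≤-trans minT≤minS (min-≤ x∈S)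

strictlyMinorises⇒≻min : StrictlyMinorises T S → S ≻min T
strictlyMinorises⇒≻min {T = t ∷ ts} {S = []} _ = tt
strictlyMinorises⇒≻min {T = t ∷ ts} {S = s ∷ ss} (y , y∈T , y<S) =
  ≤-<-trans (min-≤ y∈T) (y<S (min-∈ {S = s ∷ ss} λ ()))

≻min⇒strictlyMinorises : S ≻min T → StrictlyMinorises T S
≻min⇒strictlyMinorises {[]} {t ∷ ts} _ = t , here refl , λ ()
≻min⇒strictlyMinorises {s ∷ ss} {t ∷ ts} minT<minS =
  μval min (t ∷ ts) , min-∈ (λ ()) , λ x∈S → <-≤-trans minT<minS (min-≤ x∈S)

≿max⇒max≤ : T ≢ [] → S ≿max T → μval max T ≤ μval max S
≿max⇒max≤ T≢[] S≿T with ≿max⇒majorises S≿T (max-∈ T≢[])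
... | x , x∈S , maxT≤x = ≤-trans maxT≤x (≤-max x∈S)

≻max⇒max< : T ≢ [] → S ≻max T → μval max T < μval max S
≻max⇒max< T≢[] S≻T with ≻max⇒strictlyMajorises S≻T
... | x , x∈S , T<x = <-≤-trans (T<x (max-∈ T≢[])) (≤-max x∈S)

≿min⇒min≤ : S ≢ [] → S ≿min T → μval min T ≤ μval min S
≿min⇒min≤ S≢[] S≿T with ≿min⇒minorises S≿T (min-∈ S≢[])
... | y , y∈T , y≤minS = ≤-trans (min-≤ y∈T) y≤minS

≻min⇒min< : S ≢ [] → S ≻min T → μval min T < μval min S
≻min⇒min< S≢[] S≻T with ≻min⇒strictlyMinorises S≻T
... | y , y∈T , y<S = ≤-<-trans (min-≤ y∈T) (y<S (min-∈ S≢[]))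

≿ms⇒≿max : S ≿ms T → S ≿max T
≿ms⇒≿max (inj₂ S↭T) =
  majorises⇒≿max λ {y} y∈T → y , ↭.∈-resp-↭ (↭-sym S↭T) y∈T , ≤-refl
≿ms⇒≿max {S} (inj₁ (U , V , R , S↭U++R , T↭V++R , _ , U≻V)) = majorises⇒≿max dominate
  where
  inS : ∀ {x} → x ∈ U ++ R → x ∈ S
  inS = ↭.∈-resp-↭ (↭-sym S↭U++R)
  dominate : Majorises S _
  dominate {y} y∈T with ∈-++⁻ V (↭.∈-resp-↭ T↭V++R y∈T) | ≻max⇒strictlyMajorises U≻V
  ... | inj₂ y∈R | _ = y , inS (∈-++⁺ʳ U y∈R) , ≤-refl
  ... | inj₁ y∈V | x , x∈U , V<x = x , inS (∈-++⁺ˡ x∈U) , <⇒≤ (V<x y∈V)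

≿dms⇒≿min : S ≿dms T → S ≿min T
≿dms⇒≿min (inj₂ S↭T) =
  minorises⇒≿min λ {x} x∈S → x , ↭.∈-resp-↭ S↭T x∈S , ≤-refl
≿dms⇒≿min {T = T} (inj₁ (U , V , R , S↭U++R , T↭V++R , _ , U≻V)) = minorises⇒≿min dominate
  where
  inT : ∀ {y} → y ∈ V ++ R → y ∈ T
  inT = ↭.∈-resp-↭ (↭-sym T↭V++R)
  dominate : Minorises T _
  dominate {x} x∈S with ∈-++⁻ U (↭.∈-resp-↭ S↭U++R x∈S) | ≻min⇒strictlyMinorises U≻V
  ... | inj₂ x∈R | _ = x , inT (∈-++⁺ʳ V x∈R) , ≤-refl
  ... | inj₁ x∈U | y , y∈V , y<U = y , inT (∈-++⁺ˡ y∈V) , <⇒≤ (y<U x∈U)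

≻max⇒≻ms : S ≢ [] → S ≻max T → S ≻ms T
≻max⇒≻ms {S} {T} S≢[] S≻T = S , T , [] , ↭++[] S , ↭++[] T , S≢[] , S≻T

≻min⇒≻dms : T ≢ [] → S ≻min T → S ≻dms T
≻min⇒≻dms {T} {S} T≢[] S≻T = S , T , [] , ↭++[] S , ↭++[] T , T≢[] , S≻T

-- Shifting a multiset down by a constant

-‿mono-≤ : ∀ {x y u v : ℤ} → x ≤ y → u ≤ v → x - v ≤ y - u
-‿mono-≤ x≤y u≤v = +-mono-≤ x≤y (neg-mono-≤ u≤v)

-‿mono-<-≤ : ∀ {x y u v : ℤ} → x < y → u ≤ v → x - v < y - u
-‿mono-<-≤ x<y u≤v = +-mono-<-≤ x<y (neg-mono-≤ u≤v)

-‿mono-≤-< : ∀ {x y u v : ℤ} → x ≤ y → u < v → x - v < y - u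
-‿mono-≤-< x≤y u<v = +-mono-≤-< x≤y (neg-mono-< u<v)

shift : ℤ → List ℤ → List ℤ
shift a = map (_- a)

shift-≿max : a ≤ b → H ≿max H' → shift a H ≿max shift b H'
shift-≿max {a} {b} {H} {H'} a≤b H≿H' = majorises⇒≿max dominate
  where
  dominate : Majorises (shift a H) (shift b H')
  dominate y∈ with ∈-map⁻ _ y∈
  ... | h' , h'∈H' , refl with ≿max⇒majorises H≿H' h'∈H'
  ...   | h , h∈H , h'≤h = h - a , ∈-map⁺ _ h∈H , -‿mono-≤ h'≤h a≤b

shift-≻max : a ≤ b → H ≻max H' → shift a H ≻max shift b H'
shift-≻max {a} {b} {H} {H'} a≤b H≻H' with ≻max⇒strictlyMajorises H≻H'
... | x , x∈H , H'<x = strictlyMajorises⇒≻max (x - a , ∈-map⁺ _ x∈H , below)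
  where
  below : ∀ {y} → y ∈ shift b H' → y < x - a
  below y∈ with ∈-map⁻ _ y∈
  ... | h' , h'∈H' , refl = -‿mono-<-≤ (H'<x h'∈H') a≤b

shift<-≻max : a < b → H ≢ [] → H ≿max H' → shift a H ≻max shift b H'
shift<-≻max {a} {b} {H} {H'} a<b H≢[] H≿H' =
  strictlyMajorises⇒≻max (μval max H - a , ∈-map⁺ _ (max-∈ H≢[]) , below)
  where
  below : ∀ {y} → y ∈ shift b H' → y < μval max H - a
  below y∈ with ∈-map⁻ _ y∈
  ... | h' , h'∈H' , refl with ≿max⇒majorises H≿H' h'∈H'
  ...   | h , h∈H , h'≤h = -‿mono-≤-< (≤-trans h'≤h (≤-max h∈H)) a<b

shift-≿min : a ≤ b → H ≿min H' → shift a H ≿min shift b H'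
shift-≿min {a} {b} {H} {H'} a≤b H≿H' = minorises⇒≿min dominate
  where
  dominate : Minorises (shift b H') (shift a H)
  dominate x∈ with ∈-map⁻ _ x∈
  ... | h , h∈H , refl with ≿min⇒minorises H≿H' h∈H
  ...   | h' , h'∈H' , h'≤h = h' - b , ∈-map⁺ _ h'∈H' , -‿mono-≤ h'≤h a≤b

shift-≻min : a ≤ b → H ≻min H' → shift a H ≻min shift b H'
shift-≻min {a} {b} {H} {H'} a≤b H≻H' with ≻min⇒strictlyMinorises H≻H'
... | y , y∈H' , y<H = strictlyMinorises⇒≻min (y - b , ∈-map⁺ _ y∈H' , above)
  where
  above : ∀ {x} → x ∈ shift a H → y - b < x
  above x∈ with ∈-map⁻ _ x∈
  ... | h , h∈H , refl = -‿mono-<-≤ (y<H h∈H) a≤b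

shift<-≻min : a < b → H' ≢ [] → H ≿min H' → shift a H ≻min shift b H'
shift<-≻min {a} {b} {H'} {H} a<b H'≢[] H≿H' =
  strictlyMinorises⇒≻min (μval min H' - b , ∈-map⁺ _ (min-∈ H'≢[]) , above)
  where
  above : ∀ {x} → x ∈ shift a H → μval min H' - b < x
  above x∈ with ∈-map⁻ _ x∈
  ... | h , h∈H , refl with ≿min⇒minorises H≿H' h∈H
  ...   | h' , h'∈H' , h'≤h = -‿mono-≤-< (≤-trans (min-≤ h'∈H') h'≤h) a<b

shift<-≻ms : a < b → H ≢ [] → H ≿ms H' → shift a H ≻ms shift b H'
shift<-≻ms a<b H≢[] H≿H' =
  ≻max⇒≻ms (map≢[] H≢[]) (shift<-≻max a<b H≢[] (≿ms⇒≿max H≿H'))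

shift-≻ms : a ≤ b → H ≢ [] → H ≻ms H' → shift a H ≻ms shift b H'
shift-≻ms {a} {b} a≤b H≢[] H≻H' with a ≟ b
... | no a≢b = shift<-≻ms (≤∧≢⇒< a≤b a≢b) H≢[] (inj₁ H≻H')
... | yes refl with H≻H'
...   | U , V , R , H↭U++R , H'↭V++R , U≢[] , U≻V =
  shift a U , shift a V , shift a R ,
  map-↭++ _ U R H↭U++R , map-↭++ _ V R H'↭V++R ,
  map≢[] U≢[] , shift-≻max ≤-refl U≻V

shift-≿ms : a ≤ b → H ≢ [] → H ≿ms H' → shift a H ≿ms shift b H'
shift-≿ms a≤b H≢[] (inj₁ H≻H') = inj₁ (shift-≻ms a≤b H≢[] H≻H')
shift-≿ms {a} {b} a≤b H≢[] (inj₂ H↭H') with a ≟ b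
... | yes refl = inj₂ (↭.map⁺ _ H↭H')
... | no a≢b = inj₁ (shift<-≻ms (≤∧≢⇒< a≤b a≢b) H≢[] (inj₂ H↭H'))

shift<-≻dms : a < b → H' ≢ [] → H ≿dms H' → shift a H ≻dms shift b H'
shift<-≻dms a<b H'≢[] H≿H' =
  ≻min⇒≻dms (map≢[] H'≢[]) (shift<-≻min a<b H'≢[] (≿dms⇒≿min H≿H'))

shift-≻dms : a ≤ b → H' ≢ [] → H ≻dms H' → shift a H ≻dms shift b H'
shift-≻dms {a} {b} a≤b H'≢[] H≻H' with a ≟ b
... | no a≢b = shift<-≻dms (≤∧≢⇒< a≤b a≢b) H'≢[] (inj₁ H≻H')
... | yes refl with H≻H'
...   | U , V , R , H↭U++R , H'↭V++R , V≢[] , U≻V =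
  shift a U , shift a V , shift a R ,
  map-↭++ _ U R H↭U++R , map-↭++ _ V R H'↭V++R ,
  map≢[] V≢[] , shift-≻min ≤-refl U≻V

shift-≿dms : a ≤ b → H' ≢ [] → H ≿dms H' → shift a H ≿dms shift b H'
shift-≿dms a≤b H'≢[] (inj₁ H≻H') = inj₁ (shift-≻dms a≤b H'≢[] H≻H')
shift-≿dms {a} {b} a≤b H'≢[] (inj₂ H↭H') with a ≟ b
... | yes refl = inj₂ (↭.map⁺ _ H↭H')
... | no a≢b = inj₁ (shift<-≻dms (≤∧≢⇒< a≤b a≢b) H'≢[] (inj₂ H↭H'))

shift-≿ : ∀ μ → a ≤ b → H ≢ [] → H' ≢ [] → ≿[ μ ] H H' →
          ≿[ μ ] (shift a H) (shift b H')
shift-≿ max a≤b _ _ = shift-≿max a≤b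
shift-≿ min a≤b _ _ = shift-≿min a≤b
shift-≿ ms a≤b H≢[] _ = shift-≿ms a≤b H≢[]
shift-≿ dms a≤b _ H'≢[] = shift-≿dms a≤b H'≢[]

shift-≻ : ∀ μ → a ≤ b → H ≢ [] → H' ≢ [] → ≿[ μ ] H H' → ≻[ μ ] H H' ⊎ a < b →
          ≻[ μ ] (shift a H) (shift b H')
shift-≻ max a≤b H≢[] _ H≿H' =
  [ shift-≻max a≤b , (λ a<b → shift<-≻max a<b H≢[] H≿H') ]′
shift-≻ min a≤b _ H'≢[] H≿H' =
  [ shift-≻min a≤b , (λ a<b → shift<-≻min a<b H'≢[] H≿H') ]′
shift-≻ ms a≤b H≢[] _ H≿H' =
  [ shift-≻ms a≤b H≢[] , (λ a<b → shift<-≻ms a<b H≢[] H≿H') ]′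
shift-≻ dms a≤b _ H'≢[] H≿H' =
  [ shift-≻dms a≤b H'≢[] , (λ a<b → shift<-≻dms a<b H'≢[] H≿H') ]′

neg : List ℤ → List ℤ
neg = map (-_)

neg-≻max : S ≻max T → neg T ≻min neg S
neg-≻max {S} {T} S≻T with ≻max⇒strictlyMajorises S≻T
... | x , x∈S , T<x = strictlyMinorises⇒≻min (- x , ∈-map⁺ (-_) x∈S , above)
  where
  above : ∀ {y} → y ∈ neg T → - x < y
  above y∈ with ∈-map⁻ _ y∈
  ... | t , t∈T , refl = neg-mono-< (T<x t∈T)

neg-≻min : S ≻min T → neg T ≻max neg S
neg-≻min {S} {T} S≻T with ≻min⇒strictlyMinorises S≻T
... | y , y∈T , y<S = strictlyMajorises⇒≻max (- y , ∈-map⁺ (-_) y∈T , below)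
  where
  below : ∀ {x} → x ∈ neg S → x < - y
  below x∈ with ∈-map⁻ _ x∈
  ... | s , s∈S , refl = neg-mono-< (y<S s∈S)

neg-≻ms : S ≻ms T → neg T ≻dms neg S
neg-≻ms (U , V , R , S↭U++R , T↭V++R , U≢[] , U≻V) =
  neg V , neg U , neg R , map-↭++ (-_) V R T↭V++R , map-↭++ (-_) U R S↭U++R ,
  map≢[] U≢[] , neg-≻max U≻V

neg-≻dms : S ≻dms T → neg T ≻ms neg S
neg-≻dms (U , V , R , S↭U++R , T↭V++R , V≢[] , U≻V) =
  neg V , neg U , neg R , map-↭++ (-_) V R T↭V++R , map-↭++ (-_) U R S↭U++R ,
  map≢[] V≢[] , neg-≻min U≻V

neg-≿ms : S ≿ms T → neg T ≿dms neg S
neg-≿ms (inj₁ S≻T) = inj₁ (neg-≻ms S≻T)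
neg-≿ms (inj₂ S↭T) = inj₂ (↭.map⁺ (-_) (↭-sym S↭T))

neg-≿dms : S ≿dms T → neg T ≿ms neg S
neg-≿dms (inj₁ S≻T) = inj₁ (neg-≻dms S≻T)
neg-≿dms (inj₂ S↭T) = inj₂ (↭.map⁺ (-_) (↭-sym S↭T))

-- Subtracting a multiset from a constant

complement : ℤ → List ℤ → List ℤ
complement α = map (λ l → α - l)

complement≡shift∘neg : ∀ α L → complement α L ≡ shift (- α) (neg L)
complement≡shift∘neg α L = begin
  map (λ l → α - l) L       ≡⟨ map-cong α-l≡-l--α L ⟩
  map ((_- - α) ∘ -_) L      ≡⟨ map-∘ L ⟩
  shift (- α) (neg L)        ∎
  where
  open ≡-Reasoning
  α-l≡-l--α : ∀ l → α - l ≡ - l - - α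
  α-l≡-l--α l = trans (+-comm α (- l)) (cong (- l +_) (sym (neg-involutive α)))

complement-≿ms : β ≤ α → L' ≢ [] → L' ≿ms L → complement α L ≿dms complement β L'
complement-≿ms {β} {α} {L'} {L} β≤α L'≢[] L'≿L
  rewrite complement≡shift∘neg α L | complement≡shift∘neg β L' =
  shift-≿dms (neg-mono-≤ β≤α) (map≢[] L'≢[]) (neg-≿ms L'≿L)

complement-≻ms : β ≤ α → L' ≢ [] → L' ≿ms L → β < α ⊎ L' ≻ms L →
                 complement α L ≻dms complement β L'
complement-≻ms {β} {α} {L'} {L} β≤α L'≢[] L'≿L
  rewrite complement≡shift∘neg α L | complement≡shift∘neg β L' =
  [ (λ β<α → shift<-≻dms (neg-mono-< β<α) (map≢[] L'≢[]) (neg-≿ms L'≿L))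
  , (λ L'≻L → shift-≻dms (neg-mono-≤ β≤α) (map≢[] L'≢[]) (neg-≻ms L'≻L)) ]′

complement-≿dms : β ≤ α → L ≢ [] → L' ≿dms L → complement α L ≿ms complement β L'
complement-≿dms {β} {α} {L} {L'} β≤α L≢[] L'≿L
  rewrite complement≡shift∘neg α L | complement≡shift∘neg β L' =
  shift-≿ms (neg-mono-≤ β≤α) (map≢[] L≢[]) (neg-≿dms L'≿L)

complement-≻dms : β ≤ α → L ≢ [] → L' ≿dms L → β < α ⊎ L' ≻dms L →
                  complement α L ≻ms complement β L'
complement-≻dms {β} {α} {L} {L'} β≤α L≢[] L'≿L
  rewrite complement≡shift∘neg α L | complement≡shift∘neg β L' =
  [ (λ β<α → shift<-≻ms (neg-mono-< β<α) (map≢[] L≢[]) (neg-≿dms L'≿L))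
  , (λ L'≻L → shift-≻ms (neg-mono-≤ β≤α) (map≢[] L≢[]) (neg-≻dms L'≻L)) ]′

diff-≿ : ∀ {μL μH} (c : Compat μL μH) →
         L ≢ [] → H ≢ [] → L' ≢ [] → H' ≢ [] →
         ≿[ μH ] H H' → ≿[ μL ] L' L → ≿[ dtype c ] (diff c L H) (diff c L' H')
diff-≿ (maxL μH) L≢[] H≢[] _ H'≢[] H≿H' L'≿L =
  shift-≿ μH (≿max⇒max≤ L≢[] L'≿L) H≢[] H'≢[] H≿H'
diff-≿ (minL μH) _ H≢[] L'≢[] H'≢[] H≿H' L'≿L =
  shift-≿ μH (≿min⇒min≤ L'≢[] L'≿L) H≢[] H'≢[] H≿H'
diff-≿ ms-max _ _ L'≢[] H'≢[] H≿H' L'≿L =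
  complement-≿ms (≿max⇒max≤ H'≢[] H≿H') L'≢[] L'≿L
diff-≿ ms-min _ H≢[] L'≢[] _ H≿H' L'≿L =
  complement-≿ms (≿min⇒min≤ H≢[] H≿H') L'≢[] L'≿L
diff-≿ dms-max L≢[] _ _ H'≢[] H≿H' L'≿L =
  complement-≿dms (≿max⇒max≤ H'≢[] H≿H') L≢[] L'≿L
diff-≿ dms-min L≢[] H≢[] _ _ H≿H' L'≿L =
  complement-≿dms (≿min⇒min≤ H≢[] H≿H') L≢[] L'≿L

diff-≻ : ∀ {μL μH} (c : Compat μL μH) →
         L ≢ [] → H ≢ [] → L' ≢ [] → H' ≢ [] →
         ≿[ μH ] H H' → ≿[ μL ] L' L → ≻[ μH ] H H' ⊎ ≻[ μL ] L' L →
         ≻[ dtype c ] (diff c L H) (diff c L' H')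
diff-≻ (maxL μH) L≢[] H≢[] _ H'≢[] H≿H' L'≿L =
  shift-≻ μH (≿max⇒max≤ L≢[] L'≿L) H≢[] H'≢[] H≿H' ∘ map₂ (≻max⇒max< L≢[])
diff-≻ (minL μH) _ H≢[] L'≢[] H'≢[] H≿H' L'≿L =
  shift-≻ μH (≿min⇒min≤ L'≢[] L'≿L) H≢[] H'≢[] H≿H' ∘ map₂ (≻min⇒min< L'≢[])
diff-≻ ms-max _ _ L'≢[] H'≢[] H≿H' L'≿L =
  complement-≻ms (≿max⇒max≤ H'≢[] H≿H') L'≢[] L'≿L ∘ map₁ (≻max⇒max< H'≢[])
diff-≻ ms-min _ H≢[] L'≢[] _ H≿H' L'≿L =
  complement-≻ms (≿min⇒min≤ H≢[] H≿H') L'≢[] L'≿L ∘ map₁ (≻min⇒min< H≢[])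
diff-≻ dms-max L≢[] _ _ H'≢[] H≿H' L'≿L =
  complement-≻dms (≿max⇒max≤ H'≢[] H≿H') L≢[] L'≿L ∘ map₁ (≻max⇒max< H'≢[])
diff-≻ dms-min L≢[] H≢[] _ _ H≿H' L'≿L =
  complement-≻dms (≿min⇒min≤ H≢[] H≿H') L≢[] L'≿L ∘ map₁ (≻min⇒min< H≢[])

module _ {n : ℕ} {ar : Fin n → ℕ} where

  selMS≢[] : ∀ b {p : Fin n} (sel : Fin (ar p) → Maybe (Fin (totalArity ar)))
             (xs : Fin (ar p) → ℤ) {i t} → sel i ≡ just t → selMS {ar = ar} b sel xs ≢ []
  selMS≢[] b sel xs {i} sel-i≡just selMS≡[]
    with sel i | sel-i≡just | mapMaybe≡[]⇒nothing _ (allFin _) selMS≡[] (∈-allFin i)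
  ... | just _ | refl | ()

  step-src : ∀ {r : Rule ar} {s t} → Step r s t → pt s ≡ src r
  step-src (step _ _ _) = refl

  step-tgt : ∀ {r : Rule ar} {s t} → Step r s t → pt t ≡ tgt r
  step-tgt (step _ _ _) = refl

  module _ {μL μH : MType} (c : Compat μL μH) (f : LevelMapping ar)
           (nonEmpty : NonEmptySelections f) where

    lowMS≢[] : ∀ p xs → lowMS f p xs ≢ []
    lowMS≢[] p xs with (i , t , eq) , _ ← nonEmpty p = selMS≢[] (tagged f) (low f p) xs eq

    highMS≢[] : ∀ p xs → highMS f p xs ≢ []
    highMS≢[] p xs with _ , (i , t , eq) ← nonEmpty p = selMS≢[] (tagged f) (high f p) xs eq

    orients⇒Φ-≿ : ∀ {r s t} → Orients {μL = μL} {μH = μH} f r → Step r s t →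
                  ≿[ dtype c ] (Φ c f s) (Φ c f t)
    orients⇒Φ-≿ {r} (high≿ , low≿) (step xs ys π) =
      diff-≿ c (lowMS≢[] (src r) xs) (highMS≢[] (src r) xs)
               (lowMS≢[] (tgt r) ys) (highMS≢[] (tgt r) ys)
               (high≿ xs ys π) (low≿ xs ys π)

    orientsStrictly⇒Φ-≻ : ∀ {r s t} → OrientsStrictly {μL = μL} {μH = μH} f r →
                          Step r s t → ≻[ dtype c ] (Φ c f s) (Φ c f t)
    orientsStrictly⇒Φ-≻ {r} ((high≿ , low≿) , strict) (step xs ys π) =
      diff-≻ c (lowMS≢[] (src r) xs) (highMS≢[] (src r) xs)
               (lowMS≢[] (tgt r) ys) (highMS≢[] (tgt r) ys)
               (high≿ xs ys π) (low≿ xs ys π)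
               (Sum.map (λ high≻ → high≻ xs ys π) (λ low≻ → low≻ xs ys π) strict)

    bounded⇒Φ-WF : ∀ {r s t} → Bounded c f r → Step r s t → WF[ dtype c ] (Φ c f s)
    bounded⇒Φ-WF bounded (step xs ys π) = bounded xs ys π

  module _ {G : List (Rule ar)} {g : Rule ar} {k : ℕ}
           {st : Fin (suc (suc (suc k))) → State ar} {rs : Fin (suc (suc k)) → Rule ar}
           (rs∈G : ∀ i → rs i ∈ G)
           (steps : ∀ i → Step (rs i) (st (inject₁ i)) (st (suc i)))
           (first≡g : rs zero ≡ g) (last≡g : rs (fromℕ (suc k)) ≡ g) where

    run⇒cycleThrough : CycleThrough G g k (rs ∘ inject₁)
    run⇒cycleThrough = rs∈G ∘ inject₁ , linked , closed , zero , first≡g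
      where
      open ≡-Reasoning
      linked : ∀ i → tgt (rs (inject₁ (inject₁ i))) ≡ src (rs (inject₁ (suc i)))
      linked i = trans (sym (step-tgt (steps (inject₁ (inject₁ i)))))
                       (step-src (steps (inject₁ (suc i))))
      closed : tgt (rs (inject₁ (fromℕ k))) ≡ src (rs zero)
      closed = begin
        tgt (rs (inject₁ (fromℕ k)))     ≡⟨ step-tgt (steps (inject₁ (fromℕ k))) ⟨
        pt (st (suc (inject₁ (fromℕ k)))) ≡⟨ step-src (steps (fromℕ (suc k))) ⟩
        src (rs (fromℕ (suc k)))         ≡⟨ cong src (trans last≡g (sym first≡g)) ⟩
        src (rs zero)                    ∎

theorem5 : {n : ℕ} {ar : Fin n → ℕ} (G : List (Rule ar)) (g : Rule ar) →
           g ∈ G →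
           {μL μH : MType} (c : Compat μL μH) (f : LevelMapping ar) →
           NonEmptySelections f →
           (∀ (m : ℕ) (C : Fin (suc m) → Rule ar) → CycleThrough G g m C →
             (∀ i → Orients {μL = μL} {μH = μH} f (C i)) ×
             (∃ λ i → OrientsStrictly {μL = μL} {μH = μH} f (C i)) ×
             (∃ λ i → Bounded c f (C i))) →
           Anchor G g (Φ c f) ≿[ dtype c ] ≻[ dtype c ] WF[ dtype c ]
theorem5 G g _ {μL} {μH} c f nonEmpty cycles k st rs rs∈G steps first≡g last≡g
  with cycles k (rs ∘ inject₁) (run⇒cycleThrough {st = st} rs∈G steps first≡g last≡g)
... | oriented , (i , strict) , (j , bounded) =
  decreasing ,
  (inject₁ i , orientsStrictly⇒Φ-≻ c f nonEmpty strict (steps (inject₁ i))) ,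
  (inject₁ j , bounded⇒Φ-WF c f nonEmpty bounded (steps (inject₁ j)))
  where
  lastOriented : Orients {μL = μL} {μH = μH} f (rs (fromℕ (suc k)))
  lastOriented = subst (Orients {μL = μL} {μH = μH} f) (trans first≡g (sym last≡g)) (oriented zero)

  decreasing : ∀ m → ≿[ dtype c ] (Φ c f (st (inject₁ m))) (Φ c f (st (suc m)))
  decreasing m with view m
  ... | ‵inject₁ m = orients⇒Φ-≿ c f nonEmpty (oriented m) (steps (inject₁ m))
  ... | ‵fromℕ = orients⇒Φ-≿ c f nonEmpty lastOriented (steps (fromℕ (suc k)))
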